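{- For every integer $n \geq 1$, the vertex set of the Fibonacci-run graph $\mathcal{R}_n$ is the disjoint union $$V(\mathcal{R}_n) = \bigcup_{k=0}^{\lceil n/2 \rceil - 1} 1^k 0^{k+1} V(\mathcal{R}_{n-(2k+1)}) \;\cup\; 1^{\lceil n/2 \rceil} 0^{\lfloor n/2 \rfloor} V(\mathcal{R}_0).$$
   Context: A binary string is called run-constrained if every run (maximal block) of consecutive $1$s in it is immediately followed by a run of $0$s of strictly greater length. For $n \geq 1$, the Fibonacci-run graph $\mathcal{R}_n$ has vertex set $\{ w \in \{0,1\}^n : w00 \text{ is a run-constrained string of length } n+2\}$, and two vertices are adjacent iff they differ in exactly one coordinate. $\mathcal{R}_0$ is the one-vertex graph whose single vertex is the empty word. For a string $a$ and a set of strings $B$, $aB = \{ab : b \in B\}$; $1^k$ and $0^k$ denote runs of $k$ ones, respectively zeros. -}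

module Defs where

open import Data.Bool using (Bool; true; false)
open import Data.Nat using (ℕ; suc; _+_; _*_; _∸_; _<_; ⌈_/2⌉; ⌊_/2⌋)
open import Data.List using (List; []; _∷_; _++_; length; replicate)
open import Data.Product using (Σ; _×_; ∃)
open import Relation.Binary.PropositionalEquality using (_≡_; _≢_)

-- Binary strings: lists of Bool, with true = 1 and false = 0.
Word : Set
Word = List Bool

1^ : ℕ → Word
1^ k = replicate k true

0^ : ℕ → Word
0^ k = replicate k false

-- A string is run-constrained if every maximal run of 1s is immediately
-- followed by a run of 0s of strictly greater length.
-- A maximal run of 1s: w = x ++ 1^a ++ y with a ≥ 1, x not ending in 1,
-- y not starting with 1.
RunConstrained : Word → Set
RunConstrained w =
  ∀ (x : Word) (a : ℕ) (y : Word) →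
    w ≡ x ++ 1^ (suc a) ++ y →
    (∀ x' → x ≢ x' ++ (true ∷ [])) →
    (∀ y' → y ≢ true ∷ y') →
    Σ ℕ λ b → Σ Word λ z → (y ≡ 0^ b ++ z) × (suc a < b)

Vertex : ℕ → Word → Set
Vertex n w = (length w ≡ n) × RunConstrained (w ++ false ∷ false ∷ [])

Piece : ℕ → ℕ → Word → Set
Piece n k w = Σ Word λ u → Vertex (n ∸ (2 * k + 1)) u × (w ≡ 1^ k ++ 0^ (suc k) ++ u)

LastPiece : ℕ → Word → Set
LastPiece n w = Σ Word λ u → Vertex 0 u × (w ≡ 1^ ⌈ n /2⌉ ++ 0^ ⌊ n /2⌋ ++ u)

-- Peel off the leading run 1^k of w.  In w00 that run must be followed by
-- more than k zeros, so either w = 1^k 0^(k+1) u, where u00 is again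
-- run-constrained (cutting w after a 0 cannot break a run), or w = 1^k 0^m
-- with the appended 00 supplying the missing zeros, which forces m ∈ {k-1, k},
-- i.e. w = 1^⌈n/2⌉ 0^⌊n/2⌋.  Conversely, prefixing 1^k 0^j with k < j keeps a
-- word run-constrained.  The pieces are disjoint because each one fixes the
-- length of the leading run of 1s.
module Submission where

open import Defs
open import Data.Bool using (Bool; true; false)
open import Data.Nat using (ℕ; zero; suc; _+_; _*_; _∸_; _<_; _≤_; z≤n; s≤s; ⌈_/2⌉; ⌊_/2⌋)
open import Data.Nat.Properties
open import Data.Nat.Tactic.RingSolver using (solve-∀)
open import Data.List using (List; []; _∷_; _++_; length; replicate)
open import Data.List.Properties using (++-assoc; ++-identityʳ; length-++; length-replicate; ∷-injectiveʳ; ++-conicalʳ)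
open import Data.Product using (Σ; _×_; _,_)
open import Data.Sum using (_⊎_; inj₁; inj₂)
open import Data.Empty using (⊥-elim)
open import Relation.Binary.PropositionalEquality
  using (_≡_; _≢_; refl; sym; trans; cong; cong₂; subst; module ≡-Reasoning)
open import Relation.Nullary using (¬_)
open import Function.Bundles using (_⇔_; mk⇔)

NotEndingIn1 : Word → Set
NotEndingIn1 x = ∀ x' → x ≢ x' ++ true ∷ []

NotStartingWith1 : Word → Set
NotStartingWith1 y = ∀ y' → y ≢ true ∷ y'

InPieces : ℕ → Word → Set
InPieces n w = (Σ ℕ λ k → (k < ⌈ n /2⌉) × Piece n k w) ⊎ LastPiece n w

2*k+1≡1+k+k : ∀ k → 2 * k + 1 ≡ suc (k + k)
2*k+1≡1+k+k = solve-∀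

k+[1+k]≡2*k+1 : ∀ k → k + suc k ≡ 2 * k + 1
k+[1+k]≡2*k+1 = solve-∀

2*k+1≤n⇒k<⌈n/2⌉ : ∀ {k n} → 2 * k + 1 ≤ n → k < ⌈ n /2⌉
2*k+1≤n⇒k<⌈n/2⌉ {k} le =
  subst (_≤ _) (trans (cong ⌈_/2⌉ (2*k+1≡1+k+k k)) (cong suc (sym (n≡⌊n+n/2⌋ k))))
    (⌈n/2⌉-mono le)

k<⌈n/2⌉⇒2*k+1≤n : ∀ {k n} → k < ⌈ n /2⌉ → 2 * k + 1 ≤ n
k<⌈n/2⌉⇒2*k+1≤n {k} {n} k<⌈n/2⌉ with ≤-<-connex (2 * k + 1) n
... | inj₁ le = le
... | inj₂ n<2k+1 = ⊥-elim (<-irrefl refl (<-≤-trans k<⌈n/2⌉ ⌈n/2⌉≤k))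
  where
  ⌈n/2⌉≤k : ⌈ n /2⌉ ≤ k
  ⌈n/2⌉≤k = subst (⌈ n /2⌉ ≤_) (sym (n≡⌈n+n/2⌉ k))
              (⌈n/2⌉-mono (≤-pred (subst (n <_) (2*k+1≡1+k+k k) n<2k+1)))

⌈n/2⌉≤1+⌊n/2⌋ : ∀ n → ⌈ n /2⌉ ≤ suc ⌊ n /2⌋
⌈n/2⌉≤1+⌊n/2⌋ zero = z≤n
⌈n/2⌉≤1+⌊n/2⌋ (suc zero) = s≤s z≤n
⌈n/2⌉≤1+⌊n/2⌋ (suc (suc n)) = s≤s (⌈n/2⌉≤1+⌊n/2⌋ n)

halves-of-sum : ∀ {k m n} → k + m ≡ n → k ≡ m ⊎ k ≡ suc m →
  ⌈ n /2⌉ ≡ k × ⌊ n /2⌋ ≡ m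
halves-of-sum {k} refl (inj₁ refl) = sym (n≡⌈n+n/2⌉ k) , sym (n≡⌊n+n/2⌋ k)
halves-of-sum {m = m} refl (inj₂ refl) = cong suc (sym (n≡⌊n+n/2⌋ m)) , sym (n≡⌈n+n/2⌉ m)

m≤n≤1+m⇒n≡m∨n≡1+m : ∀ {m n} → m ≤ n → n ≤ suc m → n ≡ m ⊎ n ≡ suc m
m≤n≤1+m⇒n≡m∨n≡1+m m≤n n≤1+m with m≤n⇒m<n∨m≡n m≤n
... | inj₁ m<n = inj₂ (≤-antisym n≤1+m m<n)
... | inj₂ m≡n = inj₁ (sym m≡n)

++-assoc₃ : ∀ (a b c d : Word) → (a ++ b ++ c) ++ d ≡ a ++ b ++ c ++ d
++-assoc₃ a b c d = trans (++-assoc a (b ++ c) d) (cong (a ++_) (++-assoc b c d))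

replicate-++-∷ : ∀ {A : Set} j (x : A) v → replicate j x ++ x ∷ v ≡ x ∷ replicate j x ++ v
replicate-++-∷ zero x v = refl
replicate-++-∷ (suc j) x v = cong (x ∷_) (replicate-++-∷ j x v)

length-1^++0^++ : ∀ i j u → length (1^ i ++ 0^ j ++ u) ≡ i + j + length u
length-1^++0^++ i j u = begin
  length (1^ i ++ 0^ j ++ u)               ≡⟨ length-++ (1^ i) ⟩
  length (1^ i) + length (0^ j ++ u)        ≡⟨ cong (length (1^ i) +_) (length-++ (0^ j)) ⟩
  length (1^ i) + (length (0^ j) + length u) ≡⟨ cong₂ (λ a b → a + (b + length u)) (length-replicate i) (length-replicate j) ⟩
  i + (j + length u)                        ≡⟨ sym (+-assoc i j (length u)) ⟩
  i + j + length u                          ∎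
  where open ≡-Reasoning

replicate-prefix⇒≤length : ∀ {A : Set} b {x : A} xs z → xs ≡ replicate b x ++ z → b ≤ length xs
replicate-prefix⇒≤length zero xs z e = z≤n
replicate-prefix⇒≤length (suc b) (_ ∷ xs) z e = s≤s (replicate-prefix⇒≤length b xs z (∷-injectiveʳ e))

++-≡-∷ʳ : ∀ p {x} x' {t : Bool} → p ++ x ≡ x' ++ t ∷ [] →
  x ≡ [] ⊎ Σ Word λ x'' → x ≡ x'' ++ t ∷ []
++-≡-∷ʳ [] x' e = inj₂ (x' , e)
++-≡-∷ʳ (_ ∷ p) [] e = inj₁ (++-conicalʳ p _ (∷-injectiveʳ e))
++-≡-∷ʳ (_ ∷ p) (_ ∷ x') e = ++-≡-∷ʳ p x' (∷-injectiveʳ e)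

0^-notEndingIn1 : ∀ j → NotEndingIn1 (0^ j)
0^-notEndingIn1 zero [] ()
0^-notEndingIn1 zero (_ ∷ _) ()
0^-notEndingIn1 (suc j) [] ()
0^-notEndingIn1 (suc j) (_ ∷ x') e = 0^-notEndingIn1 j x' (∷-injectiveʳ e)

1^++0^-notEndingIn1 : ∀ k j → NotEndingIn1 (1^ k ++ 0^ (suc j))
1^++0^-notEndingIn1 k j x' e with ++-≡-∷ʳ (1^ k) x' e
... | inj₂ (x'' , e') = 0^-notEndingIn1 (suc j) x'' e'

leadingOnes : ∀ w → Σ ℕ λ k → Σ Word λ r → (w ≡ 1^ k ++ r) × NotStartingWith1 r
leadingOnes [] = 0 , [] , refl , λ _ ()
leadingOnes (false ∷ w) = 0 , false ∷ w , refl , λ _ ()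
leadingOnes (true ∷ w) with leadingOnes w
... | k , r , refl , r-ns = suc k , r , refl , r-ns

++00-startsWith0 : ∀ {r} → NotStartingWith1 r → Σ Word λ t → r ++ 0^ 2 ≡ false ∷ t
++00-startsWith0 {[]} _ = false ∷ [] , refl
++00-startsWith0 {false ∷ r} _ = r ++ 0^ 2 , refl
++00-startsWith0 {true ∷ r} r-ns = ⊥-elim (r-ns r refl)

0^-prefix-cases : ∀ c {b} r {s z} → c ≤ b → r ++ s ≡ 0^ b ++ z →
  (Σ Word λ u → r ≡ 0^ c ++ u) ⊎ (Σ ℕ λ m → (m < c) × (r ≡ 0^ m))
0^-prefix-cases zero r _ _ = inj₁ (r , refl)
0^-prefix-cases (suc c) [] _ _ = inj₂ (0 , s≤s z≤n , refl)
0^-prefix-cases (suc c) (false ∷ r) (s≤s c≤b) e with 0^-prefix-cases c r c≤b (∷-injectiveʳ e)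
... | inj₁ (u , refl) = inj₁ (u , refl)
... | inj₂ (m , m<c , refl) = inj₂ (suc m , s≤s m<c , refl)
0^-prefix-cases (suc c) {suc b} (true ∷ r) _ ()

1^-run-unique : ∀ m k {y t} → 1^ m ++ y ≡ 1^ k ++ false ∷ t → NotStartingWith1 y →
  m ≡ k × y ≡ false ∷ t
1^-run-unique zero zero e _ = refl , e
1^-run-unique zero (suc k) e y-ns = ⊥-elim (y-ns _ e)
1^-run-unique (suc m) (suc k) e y-ns with 1^-run-unique m k (∷-injectiveʳ e) y-ns
... | refl , y≡ = refl , y≡

1^-prefix-of-notEndingIn1 : ∀ k x {r s} → x ≢ [] → NotEndingIn1 x →
  x ++ true ∷ r ≡ 1^ k ++ s → Σ Word λ x' → (x ≡ 1^ k ++ x') × (s ≡ x' ++ true ∷ r)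
1^-prefix-of-notEndingIn1 zero x _ _ e = x , refl , sym e
1^-prefix-of-notEndingIn1 (suc k) [] x≢[] _ _ = ⊥-elim (x≢[] refl)
1^-prefix-of-notEndingIn1 (suc k) (false ∷ x) _ _ ()
1^-prefix-of-notEndingIn1 (suc k) (true ∷ []) _ x-ne _ = ⊥-elim (x-ne [] refl)
1^-prefix-of-notEndingIn1 (suc k) (true ∷ x@(_ ∷ _)) _ x-ne e
  with 1^-prefix-of-notEndingIn1 k x (λ ()) (λ x' e' → x-ne (true ∷ x') (cong (true ∷_) e')) (∷-injectiveʳ e)
... | x' , x≡ , s≡ = x' , cong (true ∷_) x≡ , s≡

RunConstrained-[] : RunConstrained []
RunConstrained-[] [] _ _ ()
RunConstrained-[] (_ ∷ _) _ _ ()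

RunConstrained-0∷ : ∀ {v} → RunConstrained v → RunConstrained (false ∷ v)
RunConstrained-0∷ rc (false ∷ x) a y refl x-ne y-ns =
  rc x a y refl (λ x' e → x-ne (false ∷ x') (cong (false ∷_) e)) y-ns

RunConstrained-0^++ : ∀ j {v} → RunConstrained v → RunConstrained (0^ j ++ v)
RunConstrained-0^++ zero rc = rc
RunConstrained-0^++ (suc j) rc = RunConstrained-0∷ (RunConstrained-0^++ j rc)

RunConstrained-drop : ∀ p {w} → NotEndingIn1 p → RunConstrained (p ++ w) → RunConstrained w
RunConstrained-drop p {w} p-ne rc x a y w≡ x-ne y-ns = rc (p ++ x) a y pw≡ px-ne y-ns
  where
  pw≡ : p ++ w ≡ (p ++ x) ++ 1^ (suc a) ++ y
  pw≡ = trans (cong (p ++_) w≡) (sym (++-assoc p x _))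
  px-ne : NotEndingIn1 (p ++ x)
  px-ne x' e with ++-≡-∷ʳ p x' e
  ... | inj₁ refl = p-ne x' (trans (sym (++-identityʳ p)) e)
  ... | inj₂ (x'' , e') = x-ne x'' e'

RunConstrained-1^++0^++ : ∀ {k j v} → k < j → RunConstrained v →
  RunConstrained (1^ k ++ 0^ j ++ v)
RunConstrained-1^++0^++ {k} {suc j} {v} (s≤s k≤j) rc [] a y w≡ _ y-ns
  with 1^-run-unique (suc a) k (sym w≡) y-ns
... | refl , y≡ = suc j , v , y≡ , s≤s k≤j
RunConstrained-1^++0^++ {k} {j} {v} _ rc x@(_ ∷ _) a y w≡ x-ne y-ns
  with 1^-prefix-of-notEndingIn1 k x (λ ()) x-ne (sym w≡)
... | x' , x≡ , s≡ =
  RunConstrained-0^++ j rc x' a y s≡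
    (λ x'' e → x-ne (1^ k ++ x'') (trans x≡ (trans (cong (1^ k ++_) e) (sym (++-assoc (1^ k) x'' _)))))
    y-ns

1^-followedBy-longer-0^ : ∀ k {t} → RunConstrained (1^ k ++ false ∷ t) →
  Σ ℕ λ b → Σ Word λ z → (false ∷ t ≡ 0^ b ++ z) × (k < b)
1^-followedBy-longer-0^ zero {t} _ = 1 , t , refl , s≤s z≤n
1^-followedBy-longer-0^ (suc k) {t} rc = rc [] k (false ∷ t) refl (0^-notEndingIn1 0) (λ _ ())

RunConstrained-++00-shape : ∀ w → RunConstrained (w ++ 0^ 2) →
  (Σ ℕ λ k → Σ Word λ u → w ≡ 1^ k ++ 0^ (suc k) ++ u)
  ⊎ (Σ ℕ λ k → Σ ℕ λ m → (k ≡ m ⊎ k ≡ suc m) × (w ≡ 1^ k ++ 0^ m))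
RunConstrained-++00-shape w rc with leadingOnes w
... | k , r , refl , r-ns with ++00-startsWith0 r-ns
... | t , r00≡ with 1^-followedBy-longer-0^ k (subst RunConstrained (trans (++-assoc (1^ k) r (0^ 2)) (cong (1^ k ++_) r00≡)) rc)
... | b , z , t≡ , k<b with 0^-prefix-cases (suc k) r k<b (trans r00≡ t≡)
... | inj₁ (u , refl) = inj₁ (k , u , refl)
... | inj₂ (m , m<1+k , refl) = inj₂ (k , m , m≤n≤1+m⇒n≡m∨n≡1+m (≤-pred m<1+k) k≤1+m , refl)
  where
  length-m00 : length (0^ m ++ 0^ 2) ≡ suc (suc m)
  length-m00 = trans (length-++ (0^ m)) (trans (cong (_+ 2) (length-replicate m)) (+-comm m 2))
  k≤1+m : k ≤ suc m
  k≤1+m = ≤-pred (≤-trans k<b (subst (b ≤_) length-m00 (replicate-prefix⇒≤length b _ z (trans r00≡ t≡))))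

1^++0∷-injective : ∀ k k' {s t} → 1^ k ++ false ∷ s ≡ 1^ k' ++ false ∷ t → k ≡ k'
1^++0∷-injective zero zero _ = refl
1^++0∷-injective (suc k) (suc k') e = cong suc (1^++0∷-injective k k' (∷-injectiveʳ e))

1^++0∷≢longer-1^++ : ∀ {k c} s t → k < c → 1^ k ++ false ∷ s ≢ 1^ c ++ t
1^++0∷≢longer-1^++ {zero} {suc c} s t _ ()
1^++0∷≢longer-1^++ {suc k} {suc c} s t (s≤s k<c) e = 1^++0∷≢longer-1^++ s t k<c (∷-injectiveʳ e)

vertex⇒inPieces : ∀ n w → Vertex n w → InPieces n w
vertex⇒inPieces n w (len , rc) with RunConstrained-++00-shape w rc
... | inj₁ (k , u , refl) = inj₁ (k , 2*k+1≤n⇒k<⌈n/2⌉ 2k+1≤n , u , (len-u , rc-u) , refl)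
  where
  n≡ : 2 * k + 1 + length u ≡ n
  n≡ = trans (cong (_+ length u) (sym (k+[1+k]≡2*k+1 k)))
         (trans (sym (length-1^++0^++ k (suc k) u)) len)
  2k+1≤n : 2 * k + 1 ≤ n
  2k+1≤n = subst (2 * k + 1 ≤_) n≡ (m≤m+n (2 * k + 1) (length u))
  len-u : length u ≡ n ∸ (2 * k + 1)
  len-u = trans (sym (m+n∸m≡n (2 * k + 1) (length u))) (cong (_∸ (2 * k + 1)) n≡)
  rc-u : RunConstrained (u ++ 0^ 2)
  rc-u = RunConstrained-drop (1^ k ++ 0^ (suc k)) (1^++0^-notEndingIn1 k k)
           (subst RunConstrained (trans (++-assoc₃ (1^ k) _ u _) (sym (++-assoc (1^ k) _ _))) rc)
... | inj₂ (k , m , k≡m∨1+m , refl) with halves-of-sum k+m≡n k≡m∨1+m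
  where
  k+m≡n : k + m ≡ n
  k+m≡n = trans (sym (cong₂ _+_ (length-replicate k) (length-replicate m)))
            (trans (sym (length-++ (1^ k))) len)
... | ⌈n/2⌉≡k , ⌊n/2⌋≡m =
  inj₂ ([] , (refl , RunConstrained-0^++ 2 RunConstrained-[]) ,
        cong₂ (λ i j → 1^ i ++ j) (sym ⌈n/2⌉≡k) (trans (cong 0^ (sym ⌊n/2⌋≡m)) (sym (++-identityʳ _))))

inPieces⇒vertex : ∀ n w → InPieces n w → Vertex n w
inPieces⇒vertex n _ (inj₁ (k , k<⌈n/2⌉ , u , (len-u , rc-u) , refl)) = len , rc
  where
  open ≡-Reasoning
  len : length (1^ k ++ 0^ (suc k) ++ u) ≡ n
  len = begin
    length (1^ k ++ 0^ (suc k) ++ u)     ≡⟨ length-1^++0^++ k (suc k) u ⟩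
    k + suc k + length u                  ≡⟨ cong₂ _+_ (k+[1+k]≡2*k+1 k) len-u ⟩
    2 * k + 1 + (n ∸ (2 * k + 1))         ≡⟨ m+[n∸m]≡n (k<⌈n/2⌉⇒2*k+1≤n k<⌈n/2⌉) ⟩
    n                                     ∎
  rc : RunConstrained ((1^ k ++ 0^ (suc k) ++ u) ++ 0^ 2)
  rc = subst RunConstrained (sym (++-assoc₃ (1^ k) _ u _)) (RunConstrained-1^++0^++ (n<1+n k) rc-u)
inPieces⇒vertex n _ (inj₂ ([] , _ , refl)) = len , rc
  where
  open ≡-Reasoning
  len : length (1^ ⌈ n /2⌉ ++ 0^ ⌊ n /2⌋ ++ []) ≡ n
  len = begin
    length (1^ ⌈ n /2⌉ ++ 0^ ⌊ n /2⌋ ++ []) ≡⟨ length-1^++0^++ ⌈ n /2⌉ ⌊ n /2⌋ [] ⟩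
    ⌈ n /2⌉ + ⌊ n /2⌋ + 0                  ≡⟨ +-identityʳ _ ⟩
    ⌈ n /2⌉ + ⌊ n /2⌋                      ≡⟨ +-comm ⌈ n /2⌉ _ ⟩
    ⌊ n /2⌋ + ⌈ n /2⌉                      ≡⟨ ⌊n/2⌋+⌈n/2⌉≡n n ⟩
    n                                      ∎
  w00≡ : (1^ ⌈ n /2⌉ ++ 0^ ⌊ n /2⌋ ++ []) ++ 0^ 2 ≡ 1^ ⌈ n /2⌉ ++ 0^ (2 + ⌊ n /2⌋) ++ []
  w00≡ = begin
    (1^ ⌈ n /2⌉ ++ 0^ ⌊ n /2⌋ ++ []) ++ 0^ 2 ≡⟨ ++-assoc₃ (1^ ⌈ n /2⌉) _ [] _ ⟩
    1^ ⌈ n /2⌉ ++ 0^ ⌊ n /2⌋ ++ 0^ 2         ≡⟨ cong (1^ ⌈ n /2⌉ ++_) (replicate-++-∷ ⌊ n /2⌋ false _) ⟩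
    1^ ⌈ n /2⌉ ++ false ∷ 0^ ⌊ n /2⌋ ++ 0^ 1 ≡⟨ cong (λ v → 1^ ⌈ n /2⌉ ++ false ∷ v) (replicate-++-∷ ⌊ n /2⌋ false []) ⟩
    1^ ⌈ n /2⌉ ++ 0^ (2 + ⌊ n /2⌋) ++ []     ∎
  rc : RunConstrained ((1^ ⌈ n /2⌉ ++ 0^ ⌊ n /2⌋ ++ []) ++ 0^ 2)
  rc = subst RunConstrained (sym w00≡) (RunConstrained-1^++0^++ (s≤s (⌈n/2⌉≤1+⌊n/2⌋ n)) RunConstrained-[])

lemma4p1 : ∀ (n : ℕ) → 1 ≤ n →
    (∀ (w : List Bool) →
       Vertex n w ⇔ ((Σ ℕ λ k → (k < ⌈ n /2⌉) × Piece n k w) ⊎ LastPiece n w))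
    × (∀ (k k' : ℕ) (w : List Bool) → k < ⌈ n /2⌉ → k' < ⌈ n /2⌉ →
         Piece n k w → Piece n k' w → k ≡ k')
    × (∀ (k : ℕ) (w : List Bool) → k < ⌈ n /2⌉ → Piece n k w → ¬ LastPiece n w)
lemma4p1 n _ =
    (λ w → mk⇔ (vertex⇒inPieces n w) (inPieces⇒vertex n w))
  , (λ k k' w _ _ (_ , _ , w≡) (_ , _ , w≡') → 1^++0∷-injective k k' (trans (sym w≡) w≡'))
  , (λ k w k<⌈n/2⌉ (_ , _ , w≡) (_ , _ , w≡') → 1^++0∷≢longer-1^++ _ _ k<⌈n/2⌉ (trans (sym w≡) w≡'))
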